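{- Let $G$ be a connected non-trivial graph and let $H$ be a graph of order $n'\ge 2$. (i) If $G$ is twins free, then $G\circ H$ is $k$-metric dimensional if and only if $k=\mathcal{C}(H)$. (ii) If $G$ contains at least one false twin and one true twin, then $G\circ H$ is $k$-metric dimensional if and only if $k=\min\{2\delta(H)+2,\,2(n'-\Delta(H)),\,\mathcal{C}(H)\}$. (iii) If $G$ is true twins free and contains at least one false twin, then $G\circ H$ is $k$-metric dimensional if and only if $k=\min\{2\delta(H)+2,\mathcal{C}(H)\}$. (iv) If $G$ is false twins free and contains at least one true twin, then $G\circ H$ is $k$-metric dimensional if and only if $k=\min\{2(n'-\Delta(H)),\mathcal{C}(H)\}$.
   Context: All graphs are finite and simple; non-trivial means at least two vertices. $\delta(H)$, $\Delta(H)$ are the minimum and maximum degree. $G\circ H$ is the lexicographic product: vertex set $V(G)\times V(H)$, with $(a,v)\sim(b,w)$ iff $ab\in E(G)$, or $a=b$ and $vw\in E(H)$. Distinct vertices $x,y$ are true twins if $N[x]=N[y]$ and false twins if $N(x)=N(y)$; a vertex is a (true/false) twin if it has a (true/false) twin partner. $G$ is twins free if it has no twins, true twins free if it has no true twins, false twins free if it has no false twins. A connected graph $X$ is $k$-metric dimensional if $k$ is the largest integer for which there is a set $S\subseteq V(X)$ such that every two distinct vertices $x,y$ admit at least $k$ vertices $w\in S$ with $d_X(x,w)\neq d_X(y,w)$. $\mathcal{C}(H)=\min_{x\neq y}|(N_H(x)\triangledown N_H(y))\cup\{x,y\}|$ ($\triangledown$ = symmetric difference). -}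

module Defs where

open import Data.Nat using (ℕ; zero; suc; _+_; _≤_; _⊓_; _⊔_)
open import Data.Bool using (Bool; true; false; _∨_; _∧_; _xor_; if_then_else_)
open import Data.Fin using (Fin; zero; suc; _≟_)
open import Data.Product using (_×_; _,_; ∃; ∃-syntax)
open import Data.Sum using (_⊎_)
open import Data.List using (List; length)
open import Data.List.Relation.Unary.All using (All)
open import Data.List.Relation.Unary.Unique.Propositional using (Unique)
open import Relation.Binary.PropositionalEquality using (_≡_; _≢_)
open import Relation.Nullary using (¬_)
open import Relation.Nullary.Decidable using (⌊_⌋)
open import Function.Bundles using (_⇔_)

record Graph (n : ℕ) : Set where
  field
    adj    : Fin n → Fin n → Bool
    sym    : ∀ x y → adj x y ≡ adj y x
    irrefl : ∀ x → adj x x ≡ false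
open Graph public

_==_ : ∀ {n} → Fin n → Fin n → Bool
a == b = ⌊ a ≟ b ⌋

lexAdj : ∀ {n m} → Graph n → Graph m → (Fin n × Fin m) → (Fin n × Fin m) → Bool
lexAdj G H (a , v) (b , w) = adj G a b ∨ ((a == b) ∧ adj H v w)

data Walk {V : Set} (E : V → V → Bool) : ℕ → V → V → Set where
  here : ∀ {x} → Walk E 0 x x
  step : ∀ {k x y z} → E x y ≡ true → Walk E k y z → Walk E (suc k) x z

Connected : ∀ {n} → Graph n → Set
Connected {n} G = ∀ (x y : Fin n) → ∃[ k ] Walk (adj G) k x y

Dist : {V : Set} (E : V → V → Bool) → V → V → ℕ → Set
Dist E x y k = Walk E k x y × (∀ m → Walk E m x y → k ≤ m)

Distinguishes : {V : Set} (E : V → V → Bool) → V → V → V → Set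
Distinguishes E x y w = ∃[ a ] ∃[ b ] (Dist E x w a × Dist E y w b × a ≢ b)

KMetricGenerator : {V : Set} (E : V → V → Bool) → ℕ → (V → Bool) → Set
KMetricGenerator {V} E k S =
  ∀ (x y : V) → x ≢ y →
    ∃[ W ] (k ≤ length W × Unique W × All (λ w → S w ≡ true) W
            × All (Distinguishes E x y) W)

KMetricDimensional : {V : Set} (E : V → V → Bool) → ℕ → Set
KMetricDimensional {V} E k =
  (∃[ S ] KMetricGenerator E k S) ×
  (∀ k' (S : V → Bool) → KMetricGenerator E k' S → k' ≤ k)

TrueTwins : ∀ {n} → Graph n → Fin n → Fin n → Set
TrueTwins G x y = x ≢ y × (∀ z → (adj G x z ∨ (x == z)) ≡ (adj G y z ∨ (y == z)))

FalseTwins : ∀ {n} → Graph n → Fin n → Fin n → Set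
FalseTwins G x y = x ≢ y × (∀ z → adj G x z ≡ adj G y z)

HasTrueTwin : ∀ {n} → Graph n → Set
HasTrueTwin G = ∃[ x ] ∃[ y ] TrueTwins G x y

HasFalseTwin : ∀ {n} → Graph n → Set
HasFalseTwin G = ∃[ x ] ∃[ y ] FalseTwins G x y

TwinsFree : ∀ {n} → Graph n → Set
TwinsFree G = ¬ HasTrueTwin G × ¬ HasFalseTwin G

TrueTwinsFree : ∀ {n} → Graph n → Set
TrueTwinsFree G = ¬ HasTrueTwin G

FalseTwinsFree : ∀ {n} → Graph n → Set
FalseTwinsFree G = ¬ HasFalseTwin G

count : ∀ n → (Fin n → Bool) → ℕ
count zero    f = 0
count (suc n) f = (if f zero then 1 else 0) + count n (λ i → f (suc i))

degree : ∀ {n} → Graph n → Fin n → ℕ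
degree {n} G v = count n (adj G v)

-- minimum / maximum of f over Fin n (junk value 0 when n = 0)
minOver : ∀ n → (Fin n → ℕ) → ℕ
minOver zero          f = 0
minOver (suc zero)    f = f zero
minOver (suc (suc n)) f = f zero ⊓ minOver (suc n) (λ i → f (suc i))

maxOver : ∀ n → (Fin n → ℕ) → ℕ
maxOver zero    f = 0
maxOver (suc n) f = f zero ⊔ maxOver n (λ i → f (suc i))

δ : ∀ {n} → Graph n → ℕ
δ {n} G = minOver n (degree G)

Δ : ∀ {n} → Graph n → ℕ
Δ {n} G = maxOver n (degree G)

twinSetSize : ∀ {n} → Graph n → Fin n → Fin n → ℕ
twinSetSize {n} H x y =
  count n (λ z → (adj H x z xor adj H y z) ∨ ((z == x) ∨ (z == y)))

IsC : ∀ {n} → Graph n → ℕ → Set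
IsC H c = (∃[ x ] ∃[ y ] (x ≢ y × twinSetSize H x y ≡ c))
        × (∀ x y → x ≢ y → c ≤ twinSetSize H x y)

-- In a connected graph the whole vertex set is a k-metric generator for k the
-- least number of vertices distinguishing a pair of distinct vertices, and no
-- generator does better on a pair attaining it; so the k-metric dimensionality
-- is that minimum. In G ∘ H the distance from (a, v) to (c, u) is d_G(a, c) for
-- a ≠ c and min(d_H(v, u), 2) for a = c. Hence (a, v) and (a, w) are
-- distinguished exactly by the (a, u) with u ∈ (N(v) ▽ N(w)) ∪ {v, w}. If a ≠ b
-- and some z ∉ {a, b} is adjacent to exactly one of a, b, the whole copy of z,
-- n' ≥ 𝒞(H) vertices, distinguishes (a, v) and (b, w). Otherwise a and b are
-- twins: all other copies are at equal distance from both, and the copies of a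
-- and b contribute (deg v + 1) + (deg w + 1) for false twins (at distance 2) and
-- (n' − deg v) + (n' − deg w) for true twins (at distance 1). Minimising over
-- the kinds of pairs that G admits gives the four formulas.

module Submission where

open import Data.Bool using (Bool; true; false; not; _∨_; _xor_; if_then_else_)
import Data.Bool as Bool
open import Data.Bool.Properties using (∨-identityʳ; ∨-zeroʳ)
open import Data.Empty using (⊥-elim)
open import Data.Fin using (Fin; zero; suc; punchIn; punchOut)
import Data.Fin as Fin
open import Data.Fin.Properties
  using (any?; punchInᵢ≢i; punchIn-injective; punchIn-punchOut)
import Data.Fin.Properties as Finₚ
open import Data.List using (List; []; _∷_; length; map; _++_; filter; tabulate; allFin; cartesianProduct)
open import Data.List.Membership.Propositional using (_∈_)
open import Data.List.Membership.Propositional.Properties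
  using (∈-allFin; ∈-cartesianProduct⁺; ∈-filter⁺; ∈-filter⁻)
open import Data.List.Properties using (length-++; filter-++; map-tabulate; length-removeAt′)
open import Data.List.Relation.Binary.Subset.Propositional using (_⊆_)
open import Data.List.Relation.Unary.All as All using (All)
open import Data.List.Relation.Unary.Any using (here; there; _─_)
open import Data.List.Relation.Unary.Unique.Propositional using (Unique; _∷_)
open import Data.List.Relation.Unary.Unique.Propositional.Properties
  using (allFin⁺; cartesianProduct⁺; filter⁺)
open import Data.Nat using (ℕ; zero; suc; _≤_; _<_; _+_; _*_; _∸_; _⊓_; z≤n; s≤s)
open import Data.Nat.Induction using (<-rec)
open import Data.Nat.Tactic.RingSolver using (solve-∀)
open import Data.Nat.Properties
open import Algebra.Properties.CommutativeMonoid.Sum +-0-commutativeMonoid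
  using (sum; sum-remove; sum-cong-≗; sum-replicate-zero)
open import Data.Product using (_×_; _,_; ∃-syntax; proj₁; proj₂)
open import Data.Sum using (_⊎_; inj₁; inj₂)
open import Function using (_∘_; id)
open import Function.Bundles using (_⇔_; mk⇔)
open import Relation.Binary.PropositionalEquality
open import Relation.Nullary using (¬_; Dec; yes; no; does; _×-dec_; ¬?)
open import Relation.Nullary.Decidable using (dec-true; dec-false; decidable-stable)
open import Level using (0ℓ)
open import Relation.Unary using (Pred; Decidable)

open import Defs hiding (sym)

-- Counting and summing over finite sets

count-cong : ∀ n {f g : Fin n → Bool} → (∀ i → f i ≡ g i) → count n f ≡ count n g
count-cong zero    f≡g = refl
count-cong (suc n) f≡g rewrite f≡g zero = cong (_ +_) (count-cong n (f≡g ∘ suc))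

count-false : ∀ n → count n (λ _ → false) ≡ 0
count-false zero    = refl
count-false (suc n) = count-false n

count-true : ∀ n → count n (λ _ → true) ≡ n
count-true zero    = refl
count-true (suc n) = cong suc (count-true n)

count-≤ : ∀ n f → count n f ≤ n
count-≤ zero    f = z≤n
count-≤ (suc n) f with f zero
... | true  = s≤s (count-≤ n (f ∘ suc))
... | false = m≤n⇒m≤1+n (count-≤ n (f ∘ suc))

count-not+count : ∀ n f → count n (not ∘ f) + count n f ≡ n
count-not+count zero    f = refl
count-not+count (suc n) f with f zero
... | true  = trans (+-suc _ _) (cong suc (count-not+count n (f ∘ suc)))
... | false = cong suc (count-not+count n (f ∘ suc))

count-not : ∀ n f → count n (not ∘ f) ≡ n ∸ count n f
count-not n f = trans (sym (m+n∸n≡m _ (count n f))) (cong (_∸ count n f) (count-not+count n f))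

count-suc-at : ∀ n (v : Fin n) {f g : Fin n → Bool} →
               f v ≡ true → g v ≡ false → (∀ u → u ≢ v → f u ≡ g u) →
               count n f ≡ suc (count n g)
count-suc-at (suc n) zero    fv gv f≡g rewrite fv | gv =
  cong suc (count-cong n (λ i → f≡g (suc i) λ ()))
count-suc-at (suc n) (suc v) fv gv f≡g rewrite f≡g zero (λ ()) =
  trans (cong (_ +_) (count-suc-at n v fv gv (λ u u≢v → f≡g (suc u) (u≢v ∘ Finₚ.suc-injective))))
        (+-suc _ _)

sum-zero : ∀ {n} (g : Fin n → ℕ) → (∀ i → g i ≡ 0) → sum g ≡ 0
sum-zero {n} g g≡0 = trans (sum-cong-≗ g≡0) (sum-replicate-zero n)

sum-≥ : ∀ {n} (g : Fin n → ℕ) a → g a ≤ sum g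
sum-≥ {suc n} g a = ≤-trans (m≤m+n (g a) _) (≤-reflexive (sym (sum-remove {i = a} g)))

sum-single : ∀ {n} (g : Fin n → ℕ) a → (∀ c → c ≢ a → g c ≡ 0) → sum g ≡ g a
sum-single {suc n} g a g≡0 = begin
  sum g                    ≡⟨ sum-remove {i = a} g ⟩
  g a + sum (g ∘ punchIn a) ≡⟨ cong (g a +_) (sum-zero _ (λ j → g≡0 _ (punchInᵢ≢i a j))) ⟩
  g a + 0                  ≡⟨ +-identityʳ (g a) ⟩
  g a                      ∎
  where open ≡-Reasoning

sum-pair : ∀ {n} (g : Fin n → ℕ) {a b} → a ≢ b → (∀ c → c ≢ a → c ≢ b → g c ≡ 0) →
           sum g ≡ g a + g b
sum-pair {suc n} g {a} {b} a≢b g≡0 = begin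
  sum g                     ≡⟨ sum-remove {i = a} g ⟩
  g a + sum (g ∘ punchIn a) ≡⟨ cong (g a +_) (sum-single (g ∘ punchIn a) j off-j) ⟩
  g a + g (punchIn a j)     ≡⟨ cong (λ x → g a + g x) (punchIn-punchOut a≢b) ⟩
  g a + g b                 ∎
  where
  open ≡-Reasoning
  j = punchOut a≢b
  off-j : ∀ k → k ≢ j → g (punchIn a k) ≡ 0
  off-j k k≢j = g≡0 _ (punchInᵢ≢i a k)
    (λ eq → k≢j (punchIn-injective a k j (trans eq (sym (punchIn-punchOut a≢b)))))

module _ {A : Set} {P : Pred A 0ℓ} (P? : Decidable P) where

  length-filter-tabulate : ∀ n (g : Fin n → A) →
                           length (filter P? (tabulate g)) ≡ count n (λ i → does (P? (g i)))
  length-filter-tabulate zero    g = refl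
  length-filter-tabulate (suc n) g with does (P? (g zero))
  ... | true  = cong suc (length-filter-tabulate n (g ∘ suc))
  ... | false = length-filter-tabulate n (g ∘ suc)

module _ {A : Set} {n : ℕ} {P : Pred (A × Fin n) 0ℓ} (P? : Decidable P) where

  length-filter-cartesianProduct :
    ∀ m (g : Fin m → A) →
    length (filter P? (cartesianProduct (tabulate g) (allFin n)))
      ≡ sum (λ c → count n (λ u → does (P? (g c , u))))
  length-filter-cartesianProduct zero    g = refl
  length-filter-cartesianProduct (suc m) g = begin
    length (filter P? (row ++ rest))                   ≡⟨ cong length (filter-++ P? row rest) ⟩
    length (filter P? row ++ filter P? rest)           ≡⟨ length-++ (filter P? row) ⟩
    length (filter P? row) + length (filter P? rest)   ≡⟨ cong₂ _+_ row-count
                                                          (length-filter-cartesianProduct m (g ∘ suc)) ⟩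
    count n (λ u → does (P? (g zero , u)))
      + sum (λ c → count n (λ u → does (P? (g (suc c) , u))))   ∎
    where
    open ≡-Reasoning
    row  = map (g zero ,_) (allFin n)
    rest = cartesianProduct (tabulate (g ∘ suc)) (allFin n)
    row-count : length (filter P? row) ≡ count n (λ u → does (P? (g zero , u)))
    row-count = trans (cong (length ∘ filter P?) (map-tabulate id (g zero ,_)))
                      (length-filter-tabulate P? n (g zero ,_))

module _ {A : Set} where

  ∈-─⁺ : ∀ {x y : A} {ys} (x∈ys : x ∈ ys) → y ∈ ys → x ≢ y → y ∈ (ys ─ x∈ys)
  ∈-─⁺ (here refl) (here refl) x≢y = ⊥-elim (x≢y refl)
  ∈-─⁺ (here _)    (there y∈)  x≢y = y∈
  ∈-─⁺ (there _)   (here refl) x≢y = here refl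
  ∈-─⁺ (there x∈)  (there y∈)  x≢y = there (∈-─⁺ x∈ y∈ x≢y)

  Unique-⊆⇒length≤ : ∀ {xs ys : List A} → Unique xs → xs ⊆ ys → length xs ≤ length ys
  Unique-⊆⇒length≤ {[]}     _          _      = z≤n
  Unique-⊆⇒length≤ {x ∷ xs} {ys} (x∉ ∷ xs!) xs⊆ys = begin
    suc (length xs)              ≤⟨ s≤s (Unique-⊆⇒length≤ xs! xs⊆ys─x) ⟩
    suc (length (ys ─ x∈ys))     ≡⟨ sym (length-removeAt′ ys _) ⟩
    length ys                    ∎
    where
    open ≤-Reasoning
    x∈ys = xs⊆ys (here refl)
    xs⊆ys─x : xs ⊆ (ys ─ x∈ys)
    xs⊆ys─x y∈xs = ∈-─⁺ x∈ys (xs⊆ys (there y∈xs)) (All.lookup x∉ y∈xs)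

minOver-≤ : ∀ m f (i : Fin m) → minOver m f ≤ f i
minOver-≤ (suc zero)    f zero    = ≤-refl
minOver-≤ (suc (suc m)) f zero    = m⊓n≤m _ _
minOver-≤ (suc (suc m)) f (suc i) = ≤-trans (m⊓n≤n (f zero) _) (minOver-≤ (suc m) (f ∘ suc) i)

minOver-attained : ∀ m f → 1 ≤ m → ∃[ i ] f i ≡ minOver m f
minOver-attained (suc zero)    f _ = zero , refl
minOver-attained (suc (suc m)) f _
  with ⊓-sel (f zero) (minOver (suc m) (f ∘ suc)) | minOver-attained (suc m) (f ∘ suc) (s≤s z≤n)
... | inj₁ eq | _        = zero , sym eq
... | inj₂ eq | i , fi≡ = suc i , trans fi≡ (sym eq)

maxOver-≥ : ∀ m f (i : Fin m) → f i ≤ maxOver m f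
maxOver-≥ (suc m) f zero    = m≤m⊔n _ _
maxOver-≥ (suc m) f (suc i) = ≤-trans (maxOver-≥ m (f ∘ suc) i) (m≤n⊔m (f zero) _)

maxOver-attained : ∀ m f → 1 ≤ m → ∃[ i ] f i ≡ maxOver m f
maxOver-attained (suc zero)    f _ = zero , sym (⊔-identityʳ (f zero))
maxOver-attained (suc (suc m)) f _
  with ⊔-sel (f zero) (maxOver (suc m) (f ∘ suc)) | maxOver-attained (suc m) (f ∘ suc) (s≤s z≤n)
... | inj₁ eq | _        = zero , sym eq
... | inj₂ eq | i , fi≡ = suc i , trans fi≡ (sym eq)

==-refl : ∀ {n} (a : Fin n) → (a == a) ≡ true
==-refl a with a Fin.≟ a
... | yes _   = refl
... | no a≢a = ⊥-elim (a≢a refl)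

==-≢ : ∀ {n} {a b : Fin n} → a ≢ b → (a == b) ≡ false
==-≢ {a = a} {b} a≢b with a Fin.≟ b
... | yes a≡b = ⊥-elim (a≢b a≡b)
... | no _    = refl

differ : ℕ → ℕ → Bool
differ m k = does (¬? (m ≟ k))

differ-refl : ∀ m → differ m m ≡ false
differ-refl m = dec-false (¬? (m ≟ m)) (λ m≢m → m≢m refl)

differ-≢ : ∀ {m k} → m ≢ k → differ m k ≡ true
differ-≢ {m} {k} = dec-true (¬? (m ≟ k))

differ-sym : ∀ m k → differ m k ≡ differ k m
differ-sym m k with m ≟ k
... | yes refl = refl
... | no m≢k   = trans (differ-≢ m≢k) (sym (differ-≢ (m≢k ∘ sym)))

-- Distances and the k-metric dimensionality of a finite graph

least-witness : {P : ℕ → Set} → Decidable P → ∀ k → P k → ∃[ m ] (P m × (∀ j → P j → m ≤ j))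
least-witness {P} P? = <-rec (λ k → P k → ∃[ m ] (P m × (∀ j → P j → m ≤ j))) search
  where
  search : ∀ k → (∀ {j} → j < k → P j → ∃[ m ] (P m × (∀ i → P i → m ≤ i))) →
           P k → ∃[ m ] (P m × (∀ j → P j → m ≤ j))
  search k below pk with anyUpTo? P? k
  ... | yes (j , j<k , pj) = below j<k pj
  ... | no none            = k , pk , λ j pj → ≮⇒≥ (λ j<k → none (j , j<k , pj))

module _ {V : Set} (E : V → V → Bool) where

  walk-0 : ∀ {x y} → Walk E 0 x y → x ≡ y
  walk-0 here = refl

  walk-1 : ∀ {x y} → Walk E 1 x y → E x y ≡ true
  walk-1 (step e here) = e

  Dist-unique : ∀ {x y a b} → Dist E x y a → Dist E x y b → a ≡ b
  Dist-unique (wa , a-min) (wb , b-min) = ≤-antisym (a-min _ wb) (b-min _ wa)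

module MetricDimension {V : Set} (E : V → V → Bool) (d : V → V → ℕ)
         (d-spec : ∀ x y → Dist E x y (d x y))
         (vs : List V) (vs! : Unique vs) (∈vs : ∀ x → x ∈ vs) where

  Separates? : ∀ x y → Decidable (λ w → d x w ≢ d y w)
  Separates? x y w = ¬? (d x w ≟ d y w)

  separators : V → V → List V
  separators x y = filter (Separates? x y) vs

  Distinguishes⇒≢ : ∀ {x y w} → Distinguishes E x y w → d x w ≢ d y w
  Distinguishes⇒≢ {x} {y} {w} (a , b , da , db , a≢b) dx≡dy =
    a≢b (trans (Dist-unique E da (d-spec x w)) (trans dx≡dy (Dist-unique E (d-spec y w) db)))

  ≢⇒Distinguishes : ∀ {x y w} → d x w ≢ d y w → Distinguishes E x y w
  ≢⇒Distinguishes {x} {y} {w} ne = d x w , d y w , d-spec x w , d-spec y w , ne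

  separators-generate : ∀ {f} → (∀ x y → x ≢ y → f ≤ length (separators x y)) →
                        KMetricGenerator E f (λ _ → true)
  separators-generate f≤ x y x≢y =
    separators x y , f≤ x y x≢y , filter⁺ (Separates? x y) {vs} vs! , All.tabulate (λ _ → refl) ,
    All.tabulate (≢⇒Distinguishes ∘ proj₂ ∘ ∈-filter⁻ (Separates? x y) {xs = vs})

  generator-bounded : ∀ {x y} → x ≢ y → ∀ k S → KMetricGenerator E k S → k ≤ length (separators x y)
  generator-bounded {x} {y} x≢y k S gen with gen x y x≢y
  ... | W , k≤|W| , W! , _ , W-dist =
    ≤-trans k≤|W| (Unique-⊆⇒length≤ W! (λ {w} w∈W →
      ∈-filter⁺ (Separates? x y) (∈vs w) (Distinguishes⇒≢ (All.lookup W-dist w∈W))))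

  KMetricDimensional⇔ : (f : ℕ) → (∀ x y → x ≢ y → f ≤ length (separators x y)) →
                        (∃[ x ] ∃[ y ] (x ≢ y × length (separators x y) ≤ f)) →
                        ∀ k → KMetricDimensional E k ⇔ k ≡ f
  KMetricDimensional⇔ f f≤ (x , y , x≢y , |sep|≤f) k = mk⇔
    (λ { ((S , gen) , maximal) → ≤-antisym (bounded k S gen) (maximal f _ (separators-generate f≤)) })
    (λ { refl → (_ , separators-generate f≤) , bounded })
    where
    bounded : ∀ k S → KMetricGenerator E k S → k ≤ f
    bounded k S gen = ≤-trans (generator-bounded x≢y k S gen) |sep|≤f

-- Twins and domination

adj-irreflexive : ∀ {n} (G : Graph n) {x y} → adj G x y ≡ true → x ≢ y
adj-irreflexive G {x} xy refl with trans (sym xy) (irrefl G x)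
... | ()

adj-sym : ∀ {n} (G : Graph n) {x y} → adj G x y ≡ true → adj G y x ≡ true
adj-sym G {x} {y} xy = trans (Graph.sym G y x) xy

Dominates : ∀ {n} → Graph n → Fin n → Fin n → Set
Dominates G b a = ∀ y → y ≢ b → adj G a y ≡ true → adj G b y ≡ true

module _ {n} (G : Graph n) where

  FalseTwins-sym : ∀ {a b} → FalseTwins G a b → FalseTwins G b a
  FalseTwins-sym (a≢b , N≡) = a≢b ∘ sym , sym ∘ N≡

  TrueTwins-sym : ∀ {a b} → TrueTwins G a b → TrueTwins G b a
  TrueTwins-sym (a≢b , N≡) = a≢b ∘ sym , sym ∘ N≡

  FalseTwins⇒Dominates : ∀ {a b} → FalseTwins G a b → Dominates G b a
  FalseTwins⇒Dominates (_ , N≡) y _ ay = trans (sym (N≡ y)) ay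

  TrueTwins⇒Dominates : ∀ {a b} → TrueTwins G a b → Dominates G b a
  TrueTwins⇒Dominates {a} {b} (_ , N≡) y y≢b ay with N≡ y
  ... | eq rewrite ay | ==-≢ (y≢b ∘ sym) | ∨-identityʳ (adj G b y) = sym eq

  TrueTwins⇒adj : ∀ {a b} → TrueTwins G a b → adj G a b ≡ true
  TrueTwins⇒adj {a} {b} (a≢b , N≡) with N≡ b
  ... | eq rewrite ==-≢ a≢b | ==-refl b | ∨-identityʳ (adj G a b) | ∨-zeroʳ (adj G b b) = eq

  -- Off {a, b} the closed and open neighbourhoods agree; at a and b the
  -- closed ones agree when ab is an edge and the open ones when it is not.
  twins-unless-separated : ∀ {a b} → a ≢ b → (∀ z → z ≢ a → z ≢ b → adj G a z ≡ adj G b z) →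
                           TrueTwins G a b ⊎ FalseTwins G a b
  twins-unless-separated {a} {b} a≢b agree with adj G a b in ab
  ... | true  = inj₁ (a≢b , closed)
    where
    closed : ∀ z → (adj G a z ∨ (a == z)) ≡ (adj G b z ∨ (b == z))
    closed z with z Fin.≟ a | z Fin.≟ b
    ... | yes refl | _ rewrite irrefl G a | ==-refl a | Graph.sym G b a | ab = refl
    ... | no _ | yes refl rewrite irrefl G b | ==-refl b | ab = refl
    ... | no z≢a | no z≢b rewrite ==-≢ (z≢a ∘ sym) | ==-≢ (z≢b ∘ sym)
                                 | ∨-identityʳ (adj G a z) | ∨-identityʳ (adj G b z) = agree z z≢a z≢b
  ... | false = inj₂ (a≢b , open′)
    where
    open′ : ∀ z → adj G a z ≡ adj G b z
    open′ z with z Fin.≟ a | z Fin.≟ b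
    ... | yes refl | _ rewrite irrefl G a | Graph.sym G b a | ab = refl
    ... | no _ | yes refl rewrite irrefl G b | ab = refl
    ... | no z≢a | no z≢b = agree z z≢a z≢b

  separated-or-twins : ∀ {a b} → a ≢ b →
                       (∃[ z ] (z ≢ a × z ≢ b × adj G a z ≢ adj G b z))
                       ⊎ TrueTwins G a b ⊎ FalseTwins G a b
  separated-or-twins {a} {b} a≢b
    with any? (λ z → ¬? (z Fin.≟ a) ×-dec ¬? (z Fin.≟ b) ×-dec ¬? (adj G a z Bool.≟ adj G b z))
  ... | yes sep  = inj₁ sep
  ... | no ¬sep = inj₂ (twins-unless-separated a≢b λ z z≢a z≢b →
                    decidable-stable (adj G a z Bool.≟ adj G b z) (λ ne → ¬sep (z , z≢a , z≢b , ne)))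

module Distance {n} (G : Graph n) (conn : Connected G) where

  walk? : ∀ k x y → Dec (Walk (adj G) k x y)
  walk? zero    x y with x Fin.≟ y
  ... | yes refl = yes here
  ... | no x≢y   = no (x≢y ∘ walk-0 (adj G))
  walk? (suc k) x z with any? (λ y → (adj G x y Bool.≟ true) ×-dec walk? k y z)
  ... | yes (y , xy , w) = yes (step xy w)
  ... | no none          = no λ { (step {y = y} xy w) → none (y , xy , w) }

  dist-exists : ∀ x y → ∃[ m ] Dist (adj G) x y m
  dist-exists x y with conn x y
  ... | k , w = least-witness (λ m → walk? m x y) k w

  dist : Fin n → Fin n → ℕ
  dist x y = proj₁ (dist-exists x y)

  dist-spec : ∀ x y → Dist (adj G) x y (dist x y)
  dist-spec x y = proj₂ (dist-exists x y)

  dist-minimal : ∀ {x y k} → Walk (adj G) k x y → dist x y ≤ k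
  dist-minimal w = proj₂ (dist-spec _ _) _ w

  walk-of-dist : ∀ {x y k} → dist x y ≡ k → Walk (adj G) k x y
  walk-of-dist {x} {y} eq = subst (λ k → Walk (adj G) k x y) eq (proj₁ (dist-spec x y))

  adj⇒dist≡1 : ∀ {x y} → adj G x y ≡ true → dist x y ≡ 1
  adj⇒dist≡1 {x} {y} xy with dist x y in eq
  ... | zero        = ⊥-elim (adj-irreflexive G xy (walk-0 (adj G) (walk-of-dist eq)))
  ... | suc zero    = refl
  ... | suc (suc k) with subst (_≤ 1) eq (dist-minimal (step xy here))
  ...   | s≤s ()

  dist≡1⇒adj : ∀ {x y} → dist x y ≡ 1 → adj G x y ≡ true
  dist≡1⇒adj eq = walk-1 (adj G) (walk-of-dist eq)

  common-neighbour⇒dist≡2 : ∀ {x y z} → x ≢ y → adj G x y ≡ false →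
                            adj G x z ≡ true → adj G z y ≡ true → dist x y ≡ 2
  common-neighbour⇒dist≡2 {x} {y} x≢y ¬xy xz zy with dist x y in eq
  ... | zero              = ⊥-elim (x≢y (walk-0 (adj G) (walk-of-dist eq)))
  ... | suc zero with trans (sym (dist≡1⇒adj eq)) ¬xy
  ...   | ()
  common-neighbour⇒dist≡2 x≢y ¬xy xz zy | suc (suc zero) = refl
  common-neighbour⇒dist≡2 x≢y ¬xy xz zy | suc (suc (suc k))
    with subst (_≤ 2) eq (dist-minimal (step xz (step zy here)))
  ... | s≤s (s≤s ())

  -- Replace the first edge a y by b y, or drop it when y = b.
  dominated-walk : ∀ {a b c k} → Dominates G b a → Walk (adj G) k a c → c ≢ a →
                   ∃[ j ] (j ≤ k × Walk (adj G) j b c)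
  dominated-walk b≽a here c≢a = ⊥-elim (c≢a refl)
  dominated-walk {b = b} b≽a (step {k = k} {y = y} ay w) c≢a with y Fin.≟ b
  ... | yes refl = k , n≤1+n k , w
  ... | no y≢b   = suc k , ≤-refl , step (b≽a y y≢b ay) w

  dist-dominated : ∀ {a b c} → Dominates G b a → c ≢ a → dist b c ≤ dist a c
  dist-dominated {a} {c = c} b≽a c≢a with dominated-walk b≽a (proj₁ (dist-spec a c)) c≢a
  ... | j , j≤ , w = ≤-trans (dist-minimal w) j≤

  dist-mutually-dominating : ∀ {a b c} → Dominates G b a → Dominates G a b →
                             c ≢ a → c ≢ b → dist a c ≡ dist b c
  dist-mutually-dominating b≽a a≽b c≢a c≢b =
    ≤-antisym (dist-dominated a≽b c≢b) (dist-dominated b≽a c≢a)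

  same-dist⇒same-adj : ∀ {a b z} → dist a z ≡ dist b z → adj G a z ≡ adj G b z
  same-dist⇒same-adj {a} {b} {z} eq with adj G a z in az | adj G b z in bz
  ... | true  | true  = refl
  ... | false | false = refl
  ... | true  | false = trans (sym (dist≡1⇒adj (trans (sym eq) (adj⇒dist≡1 az)))) bz
  ... | false | true  = trans (sym az) (dist≡1⇒adj (trans eq (adj⇒dist≡1 bz)))

  FalseTwins⇒dist≡2 : ∀ {a b z} → FalseTwins G a b → adj G a z ≡ true → dist a b ≡ 2
  FalseTwins⇒dist≡2 {a} {b} (a≢b , N≡) az =
    common-neighbour⇒dist≡2 a≢b (trans (N≡ b) (irrefl G b)) az
      (trans (Graph.sym G _ b) (trans (sym (N≡ _)) az))

-- Distances in the lexicographic product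

module Lexicographic {n n'} (G : Graph n) (H : Graph n') (conn : Connected G)
                     (neighbour : ∀ a → ∃[ z ] adj G a z ≡ true) where

  open Distance G conn public

  V : Set
  V = Fin n × Fin n'

  X : V → V → Bool
  X = lexAdj G H

  -- Within a copy, non-adjacent vertices are joined through any neighbouring copy.
  dH : Fin n' → Fin n' → ℕ
  dH v u = if v == u then 0 else (if adj H v u then 1 else 2)

  dX : V → V → ℕ
  dX (a , v) (c , u) = if a == c then dH v u else dist a c

  lift-step : ∀ {a c v u} → adj G a c ≡ true → X (a , v) (c , u) ≡ true
  lift-step {a} {c} ac rewrite ac = refl

  lift-walk : ∀ {k a c} → Walk (adj G) (suc k) a c → ∀ v u → Walk X (suc k) (a , v) (c , u)
  lift-walk (step ac here)           v u = step (lift-step ac) here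
  lift-walk (step ac w@(step _ _)) v u = step (lift-step ac) (lift-walk w u u)

  project-walk : ∀ {m p q} → Walk X m p q → ∃[ j ] (j ≤ m × Walk (adj G) j (proj₁ p) (proj₁ q))
  project-walk here = 0 , z≤n , here
  project-walk {p = a , v} (step {y = c , u} e w) with adj G a c in ac | project-walk w
  ... | true  | j , j≤ , w′ = suc j , s≤s j≤ , step ac w′
  ... | false | j , j≤ , w′ with a Fin.≟ c
  ...   | yes refl = j , m≤n⇒m≤1+n j≤ , w′
  ...   | no a≢c with () ← e

  dist-across : ∀ {a c} v u → a ≢ c → Dist X (a , v) (c , u) (dist a c)
  dist-across {a} {c} v u a≢c = walk , minimal
    where
    walk : Walk X (dist a c) (a , v) (c , u)
    walk with dist a c in eq
    ... | zero  = ⊥-elim (a≢c (walk-0 (adj G) (walk-of-dist eq)))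
    ... | suc k = lift-walk (walk-of-dist eq) v u
    minimal : ∀ m → Walk X m (a , v) (c , u) → dist a c ≤ m
    minimal m w with project-walk w
    ... | j , j≤m , w′ = ≤-trans (dist-minimal w′) j≤m

  dist-within : ∀ a v u → Dist X (a , v) (a , u) (dH v u)
  dist-within a v u with v Fin.≟ u
  ... | yes refl = here , λ _ _ → z≤n
  ... | no v≢u with adj H v u in vu
  ...   | true  = step vu′ here , λ { zero w → ⊥-elim (v≢u (cong proj₂ (walk-0 X w)))
                                    ; (suc m) w → s≤s z≤n }
    where
    vu′ : X (a , v) (a , u) ≡ true
    vu′ rewrite irrefl G a | ==-refl a | vu = refl
  ...   | false = step (lift-step {v = v} {u = v} az) (step (lift-step (adj-sym G az)) here) , minimal
    where
    az = proj₂ (neighbour a)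
    ¬vu : X (a , v) (a , u) ≡ false
    ¬vu rewrite irrefl G a | ==-refl a | vu = refl
    minimal : ∀ m → Walk X m (a , v) (a , u) → 2 ≤ m
    minimal zero          w = ⊥-elim (v≢u (cong proj₂ (walk-0 X w)))
    minimal (suc zero)    w with trans (sym (walk-1 X w)) ¬vu
    ... | ()
    minimal (suc (suc m)) w = s≤s (s≤s z≤n)

  dX-spec : ∀ p q → Dist X p q (dX p q)
  dX-spec (a , v) (c , u) with a Fin.≟ c
  ... | yes refl = dist-within a v u
  ... | no a≢c   = dist-across v u a≢c

  vertices : List V
  vertices = cartesianProduct (allFin n) (allFin n')

  open MetricDimension X dX dX-spec vertices
         (cartesianProduct⁺ (allFin⁺ n) (allFin⁺ n'))
         (λ (a , v) → ∈-cartesianProduct⁺ (∈-allFin a) (∈-allFin v)) public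

  dX-within : ∀ a v u → dX (a , v) (a , u) ≡ dH v u
  dX-within a v u rewrite ==-refl a = refl

  dX-across : ∀ {a c} v u → a ≢ c → dX (a , v) (c , u) ≡ dist a c
  dX-across v u a≢c rewrite ==-≢ a≢c = refl

  differ-dH-2 : ∀ v u → differ (dH v u) 2 ≡ (u == v) ∨ adj H v u
  differ-dH-2 v u with v Fin.≟ u
  ... | yes refl rewrite ==-refl v = refl
  ... | no v≢u rewrite ==-≢ (v≢u ∘ sym) with adj H v u
  ...   | true  = refl
  ...   | false = refl

  differ-dH-1 : ∀ v u → differ (dH v u) 1 ≡ not (adj H v u)
  differ-dH-1 v u with v Fin.≟ u
  ... | yes refl rewrite irrefl H v = refl
  ... | no _ with adj H v u
  ...   | true  = refl
  ...   | false = refl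

  differ-dH : ∀ {v w} u → v ≢ w →
              differ (dH v u) (dH w u) ≡ (adj H v u xor adj H w u) ∨ ((u == v) ∨ (u == w))
  differ-dH {v} {w} u v≢w with v Fin.≟ u | w Fin.≟ u
  ... | yes refl | yes refl = ⊥-elim (v≢w refl)
  ... | yes refl | no w≢u rewrite ==-refl v | irrefl H v with adj H w v
  ...   | true  = refl
  ...   | false = refl
  differ-dH {v} u v≢w | no v≢u | yes refl rewrite ==-refl u | irrefl H u | ==-≢ (v≢u ∘ sym)
    with adj H v u
  ...   | true  = refl
  ...   | false = refl
  differ-dH {v} {w} u v≢w | no v≢u | no w≢u rewrite ==-≢ (v≢u ∘ sym) | ==-≢ (w≢u ∘ sym)
    with adj H v u | adj H w u
  ...   | true  | true  = refl
  ...   | true  | false = refl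
  ...   | false | true  = refl
  ...   | false | false = refl

  count-differ-dH-2 : ∀ v → count n' (λ u → differ (dH v u) 2) ≡ suc (degree H v)
  count-differ-dH-2 v = trans (count-cong n' (differ-dH-2 v))
    (count-suc-at n' v (cong (_∨ adj H v v) (==-refl v)) (irrefl H v)
      (λ u u≢v → cong (_∨ adj H v u) (==-≢ u≢v)))

  count-differ-dH-1 : ∀ v → count n' (λ u → differ (dH v u) 1) ≡ n' ∸ degree H v
  count-differ-dH-1 v = trans (count-cong n' (differ-dH-1 v)) (count-not n' (adj H v))

  copySeparators : V → V → Fin n → ℕ
  copySeparators p q c = count n' (λ u → does (Separates? p q (c , u)))

  separators-by-copy : ∀ p q → length (separators p q) ≡ sum (copySeparators p q)
  separators-by-copy p q = length-filter-cartesianProduct (Separates? p q) n id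

  separators-same-copy : ∀ a {v w} → v ≢ w → length (separators (a , v) (a , w)) ≡ twinSetSize H v w
  separators-same-copy a {v} {w} v≢w =
    trans (separators-by-copy (a , v) (a , w)) (trans (sum-single _ a elsewhere) here-count)
    where
    here-count : copySeparators (a , v) (a , w) a ≡ twinSetSize H v w
    here-count = count-cong n' λ u →
      trans (cong₂ differ (dX-within a v u) (dX-within a w u)) (differ-dH u v≢w)
    elsewhere : ∀ c → c ≢ a → copySeparators (a , v) (a , w) c ≡ 0
    elsewhere c c≢a = trans (count-cong n' λ u →
        trans (cong₂ differ (dX-across v u (c≢a ∘ sym)) (dX-across w u (c≢a ∘ sym)))
              (differ-refl (dist a c)))
      (count-false n')

  separators-separated : ∀ {a b z} v w → z ≢ a → z ≢ b → adj G a z ≢ adj G b z →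
                         n' ≤ length (separators (a , v) (b , w))
  separators-separated {a} {b} {z} v w z≢a z≢b az≢bz = begin
    n'                                  ≡⟨ sym whole-copy ⟩
    copySeparators (a , v) (b , w) z    ≤⟨ sum-≥ _ z ⟩
    sum (copySeparators (a , v) (b , w)) ≡⟨ sym (separators-by-copy (a , v) (b , w)) ⟩
    length (separators (a , v) (b , w)) ∎
    where
    open ≤-Reasoning
    whole-copy : copySeparators (a , v) (b , w) z ≡ n'
    whole-copy = trans (count-cong n' λ u →
        trans (cong₂ differ (dX-across v u (z≢a ∘ sym)) (dX-across w u (z≢b ∘ sym)))
              (differ-≢ (az≢bz ∘ same-dist⇒same-adj)))
      (count-true n')

  separators-mutually-dominating :
    ∀ {a b} v w → a ≢ b → Dominates G b a → Dominates G a b →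
    length (separators (a , v) (b , w))
      ≡ count n' (λ u → differ (dH v u) (dist b a)) + count n' (λ u → differ (dH w u) (dist a b))
  separators-mutually-dominating {a} {b} v w a≢b b≽a a≽b =
    trans (separators-by-copy (a , v) (b , w)) (trans (sum-pair _ a≢b elsewhere) (cong₂ _+_ copy-a copy-b))
    where
    copy-a : copySeparators (a , v) (b , w) a ≡ count n' (λ u → differ (dH v u) (dist b a))
    copy-a = count-cong n' λ u → cong₂ differ (dX-within a v u) (dX-across w u (a≢b ∘ sym))
    copy-b : copySeparators (a , v) (b , w) b ≡ count n' (λ u → differ (dH w u) (dist a b))
    copy-b = count-cong n' λ u →
      trans (cong₂ differ (dX-across v u a≢b) (dX-within b w u)) (differ-sym (dist a b) (dH w u))
    elsewhere : ∀ c → c ≢ a → c ≢ b → copySeparators (a , v) (b , w) c ≡ 0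
    elsewhere c c≢a c≢b = trans (count-cong n' λ u →
        trans (cong₂ differ (dX-across v u (c≢a ∘ sym)) (dX-across w u (c≢b ∘ sym)))
              (trans (cong (λ d → differ d (dist b c)) (dist-mutually-dominating b≽a a≽b c≢a c≢b))
                     (differ-refl (dist b c))))
      (count-false n')

  separators-false-twins : ∀ {a b} → FalseTwins G a b → ∀ v w →
                           length (separators (a , v) (b , w)) ≡ suc (degree H v) + suc (degree H w)
  separators-false-twins {a} {b} ft v w =
    trans (separators-mutually-dominating v w (proj₁ ft)
             (FalseTwins⇒Dominates G ft) (FalseTwins⇒Dominates G (FalseTwins-sym G ft)))
      (cong₂ _+_
        (trans (cong (λ d → count n' (λ u → differ (dH v u) d))
                     (FalseTwins⇒dist≡2 (FalseTwins-sym G ft) (proj₂ (neighbour b))))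
               (count-differ-dH-2 v))
        (trans (cong (λ d → count n' (λ u → differ (dH w u) d))
                     (FalseTwins⇒dist≡2 ft (proj₂ (neighbour a))))
               (count-differ-dH-2 w)))

  separators-true-twins : ∀ {a b} → TrueTwins G a b → ∀ v w →
                          length (separators (a , v) (b , w)) ≡ (n' ∸ degree H v) + (n' ∸ degree H w)
  separators-true-twins {a} {b} tt v w =
    trans (separators-mutually-dominating v w (proj₁ tt)
             (TrueTwins⇒Dominates G tt) (TrueTwins⇒Dominates G (TrueTwins-sym G tt)))
      (cong₂ _+_
        (trans (cong (λ d → count n' (λ u → differ (dH v u) d))
                     (adj⇒dist≡1 (TrueTwins⇒adj G (TrueTwins-sym G tt))))
               (count-differ-dH-1 v))
        (trans (cong (λ d → count n' (λ u → differ (dH w u) d))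
                     (adj⇒dist≡1 (TrueTwins⇒adj G tt)))
               (count-differ-dH-1 w)))

-- The k-metric dimensionality of G ∘ H

neighbour-exists : ∀ {n} (G : Graph n) → Connected G → 2 ≤ n → ∀ a → ∃[ z ] adj G a z ≡ true
neighbour-exists G conn (s≤s (s≤s z≤n)) a with conn a (punchIn a zero)
... | zero  , w          = ⊥-elim (punchInᵢ≢i a zero (sym (walk-0 (adj G) w)))
... | suc _ , step az _ = _ , az

2*≡+ : ∀ t → 2 * t ≡ t + t
2*≡+ = solve-∀

2*+2≡suc+suc : ∀ d → 2 * d + 2 ≡ suc d + suc d
2*+2≡suc+suc = solve-∀

module Bounds {n n'} (G : Graph n) (H : Graph n') (conn : Connected G)
              (neighbour : ∀ a → ∃[ z ] adj G a z ≡ true) (a₀ : Fin n) (n'≥1 : 1 ≤ n')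
              (c : ℕ) (isC : IsC H c) where

  open Lexicographic G H conn neighbour public

  c≤n' : c ≤ n'
  c≤n' with proj₁ isC
  ... | x , y , _ , eq = ≤-trans (≤-reflexive (sym eq)) (count-≤ n' _)

  separators-same-copy-≥ : ∀ a {v w} → v ≢ w → c ≤ length (separators (a , v) (a , w))
  separators-same-copy-≥ a {v} {w} v≢w =
    ≤-trans (proj₂ isC v w v≢w) (≤-reflexive (sym (separators-same-copy a v≢w)))

  separators-true-twins-≥ : ∀ {a b} → TrueTwins G a b → ∀ v w →
                            2 * (n' ∸ Δ H) ≤ length (separators (a , v) (b , w))
  separators-true-twins-≥ {a} {b} tt v w = begin
    2 * (n' ∸ Δ H)                        ≡⟨ 2*≡+ (n' ∸ Δ H) ⟩
    (n' ∸ Δ H) + (n' ∸ Δ H)               ≤⟨ +-mono-≤ (n'∸Δ≤ v) (n'∸Δ≤ w) ⟩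
    (n' ∸ degree H v) + (n' ∸ degree H w) ≡⟨ sym (separators-true-twins tt v w) ⟩
    length (separators (a , v) (b , w))   ∎
    where
    open ≤-Reasoning
    n'∸Δ≤ : ∀ u → n' ∸ Δ H ≤ n' ∸ degree H u
    n'∸Δ≤ u = ∸-monoʳ-≤ n' (maxOver-≥ n' (degree H) u)

  separators-false-twins-≥ : ∀ {a b} → FalseTwins G a b → ∀ v w →
                             2 * δ H + 2 ≤ length (separators (a , v) (b , w))
  separators-false-twins-≥ {a} {b} ft v w = begin
    2 * δ H + 2                         ≡⟨ 2*+2≡suc+suc (δ H) ⟩
    suc (δ H) + suc (δ H)               ≤⟨ +-mono-≤ (s≤s (minOver-≤ n' (degree H) v))
                                                    (s≤s (minOver-≤ n' (degree H) w)) ⟩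
    suc (degree H v) + suc (degree H w) ≡⟨ sym (separators-false-twins ft v w) ⟩
    length (separators (a , v) (b , w)) ∎
    where open ≤-Reasoning

  separators-lower-bound : ∀ f → f ≤ c →
                           (∀ {a b} → FalseTwins G a b → f ≤ 2 * δ H + 2) →
                           (∀ {a b} → TrueTwins G a b → f ≤ 2 * (n' ∸ Δ H)) →
                           ∀ p q → p ≢ q → f ≤ length (separators p q)
  separators-lower-bound f f≤c f≤F f≤T (a , v) (b , w) p≢q with a Fin.≟ b
  ... | yes refl = ≤-trans f≤c (separators-same-copy-≥ a (p≢q ∘ cong (a ,_)))
  ... | no a≢b with separated-or-twins G a≢b
  ...   | inj₁ (z , z≢a , z≢b , az≢bz) =
    ≤-trans f≤c (≤-trans c≤n' (separators-separated v w z≢a z≢b az≢bz))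
  ...   | inj₂ (inj₁ tt) = ≤-trans (f≤T tt) (separators-true-twins-≥ tt v w)
  ...   | inj₂ (inj₂ ft) = ≤-trans (f≤F ft) (separators-false-twins-≥ ft v w)

  Attained : ℕ → Set
  Attained t = ∃[ p ] ∃[ q ] (p ≢ q × length (separators p q) ≤ t)

  attained-⊓ : ∀ {s t} → Attained s → Attained t → Attained (s ⊓ t)
  attained-⊓ {s} {t} as at with ⊓-sel s t
  ... | inj₁ eq = subst Attained (sym eq) as
  ... | inj₂ eq = subst Attained (sym eq) at

  attained-𝒞 : Attained c
  attained-𝒞 with proj₁ isC
  ... | x , y , x≢y , eq =
    (a₀ , x) , (a₀ , y) , x≢y ∘ cong proj₂ , ≤-reflexive (trans (separators-same-copy a₀ x≢y) eq)

  attained-false-twins : HasFalseTwin G → Attained (2 * δ H + 2)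
  attained-false-twins (a , b , ft) with minOver-attained n' (degree H) n'≥1
  ... | v , v-min = (a , v) , (b , v) , proj₁ ft ∘ cong proj₁ , ≤-reflexive (begin
    length (separators (a , v) (b , v)) ≡⟨ separators-false-twins ft v v ⟩
    suc (degree H v) + suc (degree H v) ≡⟨ sym (2*+2≡suc+suc (degree H v)) ⟩
    2 * degree H v + 2                  ≡⟨ cong (λ d → 2 * d + 2) v-min ⟩
    2 * δ H + 2                         ∎)
    where open ≡-Reasoning

  attained-true-twins : HasTrueTwin G → Attained (2 * (n' ∸ Δ H))
  attained-true-twins (a , b , tt) with maxOver-attained n' (degree H) n'≥1
  ... | v , v-max = (a , v) , (b , v) , proj₁ tt ∘ cong proj₁ , ≤-reflexive (begin
    length (separators (a , v) (b , v))     ≡⟨ separators-true-twins tt v v ⟩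
    (n' ∸ degree H v) + (n' ∸ degree H v)   ≡⟨ sym (2*≡+ (n' ∸ degree H v)) ⟩
    2 * (n' ∸ degree H v)                   ≡⟨ cong (λ d → 2 * (n' ∸ d)) v-max ⟩
    2 * (n' ∸ Δ H)                          ∎)
    where open ≡-Reasoning

corollary7 : ∀ {n n'} (G : Graph n) (H : Graph n') →
    Connected G → 2 ≤ n → 2 ≤ n' →
    ∀ (c : ℕ) → IsC H c →
      (TwinsFree G →
        ∀ k → KMetricDimensional (lexAdj G H) k ⇔ k ≡ c)
    × (HasFalseTwin G → HasTrueTwin G →
        ∀ k → KMetricDimensional (lexAdj G H) k ⇔
              k ≡ (2 * δ H + 2) ⊓ (2 * (n' ∸ Δ H)) ⊓ c)
    × (TrueTwinsFree G → HasFalseTwin G →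
        ∀ k → KMetricDimensional (lexAdj G H) k ⇔ k ≡ (2 * δ H + 2) ⊓ c)
    × (FalseTwinsFree G → HasTrueTwin G →
        ∀ k → KMetricDimensional (lexAdj G H) k ⇔ k ≡ (2 * (n' ∸ Δ H)) ⊓ c)
corollary7 {n} G H conn 2≤n@(s≤s (s≤s z≤n)) (s≤s _) c isC =
    (λ (no-tt , no-ft) → KMetricDimensional⇔ c
       (separators-lower-bound _ ≤-refl (vacuous no-ft) (vacuous no-tt))
       attained-𝒞)
  , (λ ft tt → KMetricDimensional⇔ _
       (separators-lower-bound _ (m⊓n≤n _ c) (λ _ → ≤-trans (m⊓n≤m _ c) (m⊓n≤m _ _))
                                             (λ _ → ≤-trans (m⊓n≤m _ c) (m⊓n≤n _ _)))
       (attained-⊓ (attained-⊓ (attained-false-twins ft) (attained-true-twins tt)) attained-𝒞))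
  , (λ no-tt ft → KMetricDimensional⇔ _
       (separators-lower-bound _ (m⊓n≤n _ c) (λ _ → m⊓n≤m _ c) (vacuous no-tt))
       (attained-⊓ (attained-false-twins ft) attained-𝒞))
  , (λ no-ft tt → KMetricDimensional⇔ _
       (separators-lower-bound _ (m⊓n≤n _ c) (vacuous no-ft) (λ _ → m⊓n≤m _ c))
       (attained-⊓ (attained-true-twins tt) attained-𝒞))
  where
  open Bounds G H conn (neighbour-exists G conn 2≤n) zero (s≤s z≤n) c isC
  vacuous : ∀ {R : Fin n → Fin n → Set} {A : Set} → ¬ (∃[ a ] ∃[ b ] R a b) → ∀ {a b} → R a b → A
  vacuous none r = ⊥-elim (none (_ , _ , r))
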